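{- Let $G_0,G_1\in\mathbb{Z}$ with $\gcd(G_0,G_1)=1$, and let $(G_n)_{n\ge0}$ satisfy $G_n=G_{n-1}+G_{n-2}$ for $n\ge 2$. Then for all $k\ge 1$, $$\mathcal{G}_{G_0,G_1}(k)=\operatorname{lcm}\{m \mid \pi_{G_0,G_1}(m)\text{ divides }k\}.$$
   Context: For a positive integer $k$, $\mathcal{G}_{G_0,G_1}(k)$ is the greatest common divisor of all the integers $\sum_{i=0}^{k-1}G_{n+i}$, $n\ge 1$. For an integer $m\ge 2$, the generalized Pisano period $\pi_{G_0,G_1}(m)$ is the smallest positive integer $r$ such that $G_r\equiv G_0 \pmod m$ and $G_{r+1}\equiv G_1\pmod m$ (the sequence modulo $m$ is periodic, so this exists). In the set $\{m \mid \pi_{G_0,G_1}(m)\text{ divides }k\}$, $m$ ranges over integers $m\ge 2$ (together with $m=1$, or equivalently with the convention that the lcm of the empty set is $1$). -}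

module Defs where

open import Data.Nat as ℕ using (ℕ; zero; suc; _<_; _≤_)
open import Data.Nat.Divisibility as ℕD using ()
open import Data.Integer as ℤ using (ℤ; +_)
open import Data.Integer.Divisibility as ℤD using ()
open import Data.Integer.GCD as ℤG using ()
open import Data.Product using (Σ; _×_)
open import Relation.Binary.PropositionalEquality using (_≡_)

IsGibonacci : (ℕ → ℤ) → Set
IsGibonacci G = ∀ n → G (suc (suc n)) ≡ G (suc n) ℤ.+ G n

blockSum : (ℕ → ℤ) → ℕ → ℕ → ℤ
blockSum G n zero    = + 0
blockSum G n (suc k) = blockSum G n k ℤ.+ G (n ℕ.+ k)

_≡_[mod_] : ℤ → ℤ → ℕ → Set
a ≡ b [mod m ] = (+ m) ℤD.∣ (a ℤ.- b)

IsPisanoPeriod : (ℕ → ℤ) → ℕ → ℕ → Set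
IsPisanoPeriod G m r =
  (0 < r) × (G r ≡ G 0 [mod m ]) × (G (suc r) ≡ G 1 [mod m ]) ×
  (∀ s → 0 < s → G s ≡ G 0 [mod m ] → G (suc s) ≡ G 1 [mod m ] → r ≤ s)

InPeriodSet : (ℕ → ℤ) → ℕ → ℕ → Set
InPeriodSet G k m = (1 ≤ m) × Σ ℕ (λ r → IsPisanoPeriod G m r × r ℕD.∣ k)

IsGcdOfBlockSums : (ℕ → ℤ) → ℕ → ℕ → Set
IsGcdOfBlockSums G k d =
  (∀ n → 1 ≤ n → (+ d) ℤD.∣ blockSum G n k) ×
  (∀ c → (∀ n → 1 ≤ n → (+ c) ℤD.∣ blockSum G n k) → c ℕD.∣ d)

IsLcmOf : (ℕ → Set) → ℕ → Set
IsLcmOf P L =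
  (∀ m → P m → m ℕD.∣ L) ×
  (∀ c → (∀ m → P m → m ℕD.∣ c) → L ℕD.∣ c)

{-# OPTIONS --safe #-}
-- The block sum Σ_{i<k} G (n+i) telescopes to D (n+1), where D n = G (n+k) − G n is again a
-- Gibonacci sequence.  An integer divides every term of a Gibonacci sequence as soon as it
-- divides two consecutive ones, so m divides all block sums iff m divides D 0 and D 1, i.e.
-- iff G k ≡ G 0 and G (k+1) ≡ G 1 (mod m).  Such "return times" are closed under addition
-- and subtraction, so the least one, π(m), divides each of them; hence m divides all block
-- sums iff π(m) ∣ k.  The gcd of the block sums therefore has exactly the members of the
-- period set as its divisors, which makes it their lcm.
module Submission where

open import Defs
open import Data.Nat using (ℕ; _≤_)
open import Data.Integer using (ℤ; +_)
open import Data.Integer.GCD using (gcd)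
open import Data.Product using (Σ; _×_)
open import Relation.Binary.PropositionalEquality using (_≡_)

open import Data.Nat as ℕ using (zero; suc; _<_; z≤n; s≤s)
import Data.Nat.Properties as ℕP
open import Data.Nat.Divisibility using (_∣_; divides; _∣0; ∣-refl; ∣-trans; ∣⇒≤; m%n≡0⇒n∣m)
import Data.Nat.GCD as ℕG
open import Data.Nat.DivMod using (_/_; _%_; m≡m%n+[m/n]*n; m%n<n)
open import Data.Integer as ℤ using (_-_; ∣_∣)
open import Data.Integer.Divisibility.Signed as Signed
  using (∣ᵤ⇒∣; ∣⇒∣ᵤ; ∣m∣n⇒∣m+n; ∣m∣n⇒∣m-n; ∣m+n∣m⇒∣n) renaming (_∣_ to _∣ℤ_)
open import Data.Integer.Divisibility using () renaming (_∣_ to _∣ᵤ_)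
import Data.Integer.Properties as ℤP
open import Data.Integer.Tactic.RingSolver using (solve-∀)
open import Data.Product using (_,_; ∃)
open import Data.Sum using (_⊎_; inj₁; inj₂)
open import Data.Empty using (⊥-elim)
open import Function using (_∘_)
open import Relation.Nullary using (yes; no)
open import Relation.Nullary.Decidable using (_×-dec_)
open import Relation.Unary using (Decidable)
open import Relation.Binary.PropositionalEquality
  using (refl; sym; cong; cong₂; subst; module ≡-Reasoning)
open ≡-Reasoning

module _ {s : ℕ → ℤ} (gib : IsGibonacci s) {c : ℤ} where

  ∣-gibonacci : c ∣ℤ s 0 → c ∣ℤ s 1 → ∀ n → c ∣ℤ s n
  ∣-gibonacci c∣s₀ c∣s₁ zero          = c∣s₀
  ∣-gibonacci c∣s₀ c∣s₁ (suc zero)    = c∣s₁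
  ∣-gibonacci c∣s₀ c∣s₁ (suc (suc n)) =
    subst (c ∣ℤ_) (sym (gib n)) (∣m∣n⇒∣m+n (∣-gibonacci c∣s₀ c∣s₁ (suc n)) (∣-gibonacci c∣s₀ c∣s₁ n))

  ∣-gibonacci-pred : ∀ {n} → c ∣ℤ s (suc n) → c ∣ℤ s (suc (suc n)) → c ∣ℤ s n
  ∣-gibonacci-pred {n} c∣s₁ c∣s₂ = ∣m+n∣m⇒∣n (subst (c ∣ℤ_) (gib n) c∣s₂) c∣s₁

LeastPositive : (ℕ → Set) → ℕ → Set
LeastPositive P r = 0 < r × P r × (∀ s → 0 < s → P s → r ≤ s)

module _ {P : ℕ → Set} where

  leastPositive : Decidable P → ∀ {n} → 0 < n → P n → ∃ (LeastPositive P)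
  leastPositive P? {n} 0<n Pn with searchUpTo n
    where
    searchUpTo : ∀ b → ∃ (LeastPositive P) ⊎ (∀ s → 0 < s → P s → b < s)
    searchUpTo zero = inj₂ λ _ 0<s _ → 0<s
    searchUpTo (suc b) with searchUpTo b | P? (suc b)
    ... | inj₁ least | _     = inj₁ least
    ... | inj₂ b<    | yes P = inj₁ (suc b , s≤s z≤n , P , b<)
    ... | inj₂ b<    | no ¬P =
      inj₂ λ s 0<s Ps → ℕP.≤∧≢⇒< (b< s 0<s Ps) (λ { refl → ¬P Ps })
  ... | inj₁ least = least
  ... | inj₂ n<    = ⊥-elim (ℕP.<-irrefl refl (n< n 0<n Pn))

  -- The remainder n % r lies in P and is smaller than r, so it must vanish.
  leastPositive-∣ : P 0 → (∀ {a b} → P a → P b → P (a ℕ.+ b)) →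
                    (∀ {a b} → P (a ℕ.+ b) → P b → P a) →
                    ∀ {r n} → LeastPositive P r → P n → r ∣ n
  leastPositive-∣ P0 P-+ P-∸ {r@(suc _)} {n} (_ , Pr , least) Pn with n % r ℕ.≟ 0
  ... | yes n%r≡0 = m%n≡0⇒n∣m n r n%r≡0
  ... | no  n%r≢0 = ⊥-elim (ℕP.<⇒≱ (m%n<n n r) (least (n % r) (ℕP.n≢0⇒n>0 n%r≢0) P[n%r]))
    where
    P[q*r] : ∀ q → P (q ℕ.* r)
    P[q*r] zero    = P0
    P[q*r] (suc q) = P-+ Pr (P[q*r] q)
    P[n%r] : P (n % r)
    P[n%r] = P-∸ (subst P (m≡m%n+[m/n]*n n r) Pn) (P[q*r] (n / r))

divisors-isLcmOf : ∀ {P : ℕ → Set} {d} → (∀ m → P m → m ∣ d) → (∀ m → 0 < m → m ∣ d → P m) →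
                   IsLcmOf P d
divisors-isLcmOf {P} {d} P⇒∣d ∣d⇒P = P⇒∣d , least d ∣d⇒P
  where
  least : ∀ d → (∀ m → 0 < m → m ∣ d → P m) → ∀ c → (∀ m → P m → m ∣ c) → d ∣ c
  least (suc e) ∣e⇒P c P⇒∣c = P⇒∣c (suc e) (∣e⇒P (suc e) (s≤s z≤n) ∣-refl)
  least zero    _    zero    _    = ∣-refl
  least zero    ∣0⇒P (suc c) P⇒∣c =
    ⊥-elim (ℕP.<-irrefl refl (∣⇒≤ (P⇒∣c (suc (suc c)) (∣0⇒P (suc (suc c)) (s≤s z≤n) (_ ∣0)))))

IsPeriod : (ℕ → ℤ) → ℕ → ℕ → Set
IsPeriod G m s = (+ m) ∣ℤ G s - G 0 × (+ m) ∣ℤ G (suc s) - G 1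

shiftDiff : (ℕ → ℤ) → ℕ → ℕ → ℤ
shiftDiff G k n = G (n ℕ.+ k) - G n

module GibonacciPeriods {G : ℕ → ℤ} (gib : IsGibonacci G) where

  shiftDiff-gibonacci : ∀ k → IsGibonacci (shiftDiff G k)
  shiftDiff-gibonacci k n = begin
    G (suc (suc n) ℕ.+ k) - G (suc (suc n))
      ≡⟨ cong₂ _-_ (gib (n ℕ.+ k)) (gib n) ⟩
    (G (suc n ℕ.+ k) ℤ.+ G (n ℕ.+ k)) - (G (suc n) ℤ.+ G n)
      ≡⟨ interchange (G (suc n ℕ.+ k)) (G (n ℕ.+ k)) (G (suc n)) (G n) ⟩
    shiftDiff G k (suc n) ℤ.+ shiftDiff G k n
      ∎
    where
    interchange : ∀ a b c d → (a ℤ.+ b) - (c ℤ.+ d) ≡ (a - c) ℤ.+ (b - d)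
    interchange = solve-∀

  blockSum≡shiftDiff : ∀ n k → blockSum G n k ≡ shiftDiff G k (suc n)
  blockSum≡shiftDiff n zero = begin
    + 0
      ≡⟨ sym (ℤP.+-inverseʳ (G (suc n))) ⟩
    G (suc n) - G (suc n)
      ≡⟨ cong (λ i → G (suc i) - G (suc n)) (sym (ℕP.+-identityʳ n)) ⟩
    G (suc (n ℕ.+ 0)) - G (suc n)
      ∎
  blockSum≡shiftDiff n (suc k) = begin
    blockSum G n k ℤ.+ G (n ℕ.+ k)
      ≡⟨ cong (ℤ._+ G (n ℕ.+ k)) (blockSum≡shiftDiff n k) ⟩
    (G (suc (n ℕ.+ k)) - G (suc n)) ℤ.+ G (n ℕ.+ k)
      ≡⟨ swap (G (suc (n ℕ.+ k))) (G (suc n)) (G (n ℕ.+ k)) ⟩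
    (G (suc (n ℕ.+ k)) ℤ.+ G (n ℕ.+ k)) - G (suc n)
      ≡⟨ cong (_- G (suc n)) (sym (gib (n ℕ.+ k))) ⟩
    G (suc (suc (n ℕ.+ k))) - G (suc n)
      ≡⟨ cong (λ i → G (suc i) - G (suc n)) (sym (ℕP.+-suc n k)) ⟩
    G (suc (n ℕ.+ suc k)) - G (suc n)
      ∎
    where
    swap : ∀ a b c → (a - b) ℤ.+ c ≡ (a ℤ.+ c) - b
    swap = solve-∀

  period-shiftDiff : ∀ {m s} → IsPeriod G m s → ∀ n → (+ m) ∣ℤ shiftDiff G s n
  period-shiftDiff {s = s} (≡₀ , ≡₁) = ∣-gibonacci (shiftDiff-gibonacci s) ≡₀ ≡₁

  period-zero : ∀ {m} → IsPeriod G m 0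
  period-zero {m} = ∣x-x (G 0) , ∣x-x (G 1)
    where
    ∣x-x : ∀ x → (+ m) ∣ℤ x - x
    ∣x-x x = subst ((+ m) ∣ℤ_) (sym (ℤP.+-inverseʳ x)) (∣ᵤ⇒∣ (m ∣0))

  period-+ : ∀ {m a b} → IsPeriod G m a → IsPeriod G m b → IsPeriod G m (a ℕ.+ b)
  period-+ {m} {a} {b} (a₀ , a₁) pb =
    subst ((+ m) ∣ℤ_) (split (G (a ℕ.+ b)) (G a) (G 0))
          (∣m∣n⇒∣m+n (period-shiftDiff pb a) a₀) ,
    subst ((+ m) ∣ℤ_) (split (G (suc a ℕ.+ b)) (G (suc a)) (G 1))
          (∣m∣n⇒∣m+n (period-shiftDiff pb (suc a)) a₁)
    where
    split : ∀ x y z → (x - y) ℤ.+ (y - z) ≡ x - z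
    split = solve-∀

  period-∸ : ∀ {m a b} → IsPeriod G m (a ℕ.+ b) → IsPeriod G m b → IsPeriod G m a
  period-∸ {m} {a} {b} (ab₀ , ab₁) pb =
    subst ((+ m) ∣ℤ_) (split (G (a ℕ.+ b)) (G a) (G 0))
          (∣m∣n⇒∣m-n ab₀ (period-shiftDiff pb a)) ,
    subst ((+ m) ∣ℤ_) (split (G (suc a ℕ.+ b)) (G (suc a)) (G 1))
          (∣m∣n⇒∣m-n ab₁ (period-shiftDiff pb (suc a)))
    where
    split : ∀ x y z → (x - z) - (x - y) ≡ y - z
    split = solve-∀

  period? : ∀ m → Decidable (IsPeriod G m)
  period? m s = ((+ m) Signed.∣? G s - G 0) ×-dec ((+ m) Signed.∣? G (suc s) - G 1)

  period⇒∣blockSum : ∀ {m k} → IsPeriod G m k → ∀ n → (+ m) ∣ℤ blockSum G n k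
  period⇒∣blockSum {m} {k} pk n =
    subst ((+ m) ∣ℤ_) (sym (blockSum≡shiftDiff n k)) (period-shiftDiff pk (suc n))

  ∣blockSum⇒period : ∀ {m k} → (+ m) ∣ℤ blockSum G 1 k → (+ m) ∣ℤ blockSum G 2 k → IsPeriod G m k
  ∣blockSum⇒period {m} {k} ∣S₁ ∣S₂ = ∣D₀ , ∣D₁
    where
    ∣D : ℕ → Set
    ∣D n = (+ m) ∣ℤ shiftDiff G k n
    ∣D₂ : ∣D 2
    ∣D₂ = subst ((+ m) ∣ℤ_) (blockSum≡shiftDiff 1 k) ∣S₁
    ∣D₃ : ∣D 3
    ∣D₃ = subst ((+ m) ∣ℤ_) (blockSum≡shiftDiff 2 k) ∣S₂
    ∣D₁ : ∣D 1
    ∣D₁ = ∣-gibonacci-pred {s = shiftDiff G k} (shiftDiff-gibonacci k) {c = + m} ∣D₂ ∣D₃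
    ∣D₀ : ∣D 0
    ∣D₀ = ∣-gibonacci-pred {s = shiftDiff G k} (shiftDiff-gibonacci k) {c = + m} ∣D₁ ∣D₂

  inPeriodSet⇒period : ∀ {k m} → InPeriodSet G k m → IsPeriod G m k
  inPeriodSet⇒period {m = m} (_ , r , (_ , r₀ , r₁ , _) , divides q refl) = multiple q
    where
    multiple : ∀ q → IsPeriod G m (q ℕ.* r)
    multiple zero    = period-zero
    multiple (suc q) = period-+ (∣ᵤ⇒∣ r₀ , ∣ᵤ⇒∣ r₁) (multiple q)

  period⇒inPeriodSet : ∀ {k m} → 0 < k → 0 < m → IsPeriod G m k → InPeriodSet G k m
  period⇒inPeriodSet {m = m} 0<k 0<m pk with leastPositive (period? m) 0<k pk
  ... | r , least@(0<r , (r₀ , r₁) , minimal) =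
    0<m , r , (0<r , ∣⇒∣ᵤ r₀ , ∣⇒∣ᵤ r₁ , λ s 0<s s₀ s₁ → minimal s 0<s (∣ᵤ⇒∣ s₀ , ∣ᵤ⇒∣ s₁)) ,
    leastPositive-∣ period-zero period-+ period-∸ least pk

theorem3p11 : (G : ℕ → ℤ) → IsGibonacci G → gcd (G 0) (G 1) ≡ + 1 →
    (k : ℕ) → 1 ≤ k →
    Σ ℕ (λ d → IsGcdOfBlockSums G k d × IsLcmOf (InPeriodSet G k) d)
theorem3p11 G gib _ k 0<k =
  d , (d∣blockSums , ∣blockSums⇒∣d) ,
  divisors-isLcmOf (λ m → period⇒∣d ∘ inPeriodSet⇒period)
                   (λ m 0<m → period⇒inPeriodSet 0<k 0<m ∘ ∣d⇒period)
  where
  open GibonacciPeriods {G} gib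
  S₁ S₂ : ℤ
  S₁ = blockSum G 1 k
  S₂ = blockSum G 2 k
  d : ℕ
  d = ℕG.gcd ∣ S₁ ∣ ∣ S₂ ∣

  ∣d⇒period : ∀ {m} → m ∣ d → IsPeriod G m k
  ∣d⇒period m∣d = ∣blockSum⇒period (∣ᵤ⇒∣ (∣-trans m∣d (ℕG.gcd[m,n]∣m ∣ S₁ ∣ ∣ S₂ ∣)))
                                   (∣ᵤ⇒∣ (∣-trans m∣d (ℕG.gcd[m,n]∣n ∣ S₁ ∣ ∣ S₂ ∣)))

  period⇒∣d : ∀ {m} → IsPeriod G m k → m ∣ d
  period⇒∣d pk = ℕG.gcd-greatest (∣⇒∣ᵤ (period⇒∣blockSum pk 1)) (∣⇒∣ᵤ (period⇒∣blockSum pk 2))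

  d∣blockSums : ∀ n → 1 ≤ n → (+ d) ∣ᵤ blockSum G n k
  d∣blockSums n _ = ∣⇒∣ᵤ (period⇒∣blockSum (∣d⇒period ∣-refl) n)

  ∣blockSums⇒∣d : ∀ c → (∀ n → 1 ≤ n → (+ c) ∣ᵤ blockSum G n k) → c ∣ d
  ∣blockSums⇒∣d c ∣S = ℕG.gcd-greatest (∣S 1 (s≤s z≤n)) (∣S 2 (s≤s z≤n))
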